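{- The number $|\mathcal{M}_3(T)|$ is not bounded by any function of the run-length encoding size $m$ of $T$: there is no function $f$ such that $|\mathcal{M}_3(T)|\le f(m)$ for all strings $T$ (of the form described in the context) with run-length encoding size $m$.
   Context: $\Sigma$ is an ordered alphabet, $\$\notin\Sigma$, and $T$ is a string of length $n\ge3$ with $T[1]=T[n]=\$$ and $T[2..n-1]\in\Sigma^*$; its run-length encoding size $m$ is the number of maximal runs of equal characters in $T[2..n-1]$. For a string $w$, $R(w)$ denotes the number of maximal runs of equal characters in $w$. A string $w\in\Sigma^*$ is a minimal absent word (MAW) for $T$ if $w$ does not occur in $T$ but every proper substring of $w$ occurs in $T$. Write a MAW of length at least 2 as $aub$ with $a,b\in\Sigma$, $u\in\Sigma^*$. $\mathcal{M}_3(T)$ is the set of MAWs $aub$ for $T$ with $R(aub)=3$, $a\neq u[1]$ and $b\neq u[|u|]$. -}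

module Defs where

open import Data.Nat using (ℕ; zero; suc; _+_; _<_; _≤_; _≡ᵇ_)
open import Data.Bool using (if_then_else_)
open import Data.List using (List; []; _∷_; _++_; [_]; length; map; head; last)
open import Data.List.Relation.Binary.Infix.Heterogeneous using (Infix)
open import Data.List.Relation.Unary.All using (All)
open import Data.List.Relation.Unary.Unique.Propositional using (Unique)
open import Data.Maybe using (Maybe; just; nothing)
open import Data.Product using (Σ; _×_; ∃; ∃-syntax)
open import Relation.Nullary using (¬_)
open import Relation.Binary.PropositionalEquality using (_≡_; _≢_)

-- The ordered alphabet Σ is modelled by ℕ (an infinite ordered alphabet,
-- so that strings over any finite ordered alphabet are included).
Str : Set
Str = List ℕ

data Sym : Set where
  $    : Sym
  chr  : ℕ → Sym

-- The text T = $ x $ , where x = T[2..n-1] ∈ Σ*  (so n = |x| + 2 ≥ 2;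
-- note n ≥ 3 in the paper, i.e. x nonempty, is imposed in the theorem).
text : Str → List Sym
text x = $ ∷ map chr x ++ [ $ ]

-- R(w): number of maximal runs of equal characters in w.
-- runsFrom p r = number of maximal runs in (p ∷ r).
runsFrom : ℕ → Str → ℕ
runsFrom p []      = 1
runsFrom p (y ∷ r) = (if p ≡ᵇ y then 0 else 1) + runsFrom y r

runs : Str → ℕ
runs []      = 0
runs (x ∷ r) = runsFrom x r

Occurs : Str → Str → Set
Occurs w x = Infix _≡_ (map chr w) (text x)

MAW : Str → Str → Set
MAW x w = ¬ Occurs w x
        × (∀ v → Infix _≡_ v w → length v < length w → Occurs v x)

-- 𝓜₃(T): MAWs a u b (length ≥ 2) with R(aub) = 3, a ≠ u[1], b ≠ u[|u|].
-- (u[1] and u[|u|] are compared as `head u` / `last u`; for u empty the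
--  conditions are vacuous, but then R(ab) ≤ 2 so such words are excluded.)
M3 : Str → Str → Set
M3 x w = MAW x w
       × ∃[ a ] ∃[ u ] ∃[ b ]
           ( w ≡ a ∷ u ++ [ b ]
           × runs w ≡ 3
           × just a ≢ head u
           × just b ≢ last u )

-- |P| ≤ k for a predicate P on strings: every duplicate-free list of
-- elements satisfying P has length at most k.
AtMost : ℕ → (Str → Set) → Set
AtMost k P = ∀ (ws : List Str) → Unique ws → All P ws → length ws ≤ k

-- The text T = $ 0ᵏ 1 0ᵏ $ has only three runs, yet for every 1 ≤ j ≤ k the
-- word 1 0ʲ 1 lies in 𝓜₃(T): it is absent because it contains two 1s while T
-- contains one, and each proper factor is a factor of 1 0ʲ or of 0ʲ 1, both of
-- which occur in T. So |𝓜₃(T)| ≥ k while m stays 3.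
module Submission where

open import Defs
open import Data.Nat using (ℕ; zero; suc; _+_; _≤_; _<_; _≤′_; ≤′-refl; ≤′-step; z≤n; s≤s)
open import Data.Nat.Properties
  using (_≟_; ≤-refl; ≤-trans; n≤1+n; ≤⇒≤′; +-comm; <-irrefl; 1+n≰n; +-cancelˡ-≡; suc-injective)
open import Data.List using (List; []; _∷_; _++_; [_]; length; map; filter; replicate; last; applyUpTo)
open import Data.List.Properties using (length-++; length-replicate; length-applyUpTo; map-++; ++-assoc)
open import Data.List.Relation.Binary.Infix.Heterogeneous using (Infix; here; there; _++ⁱ_; _ⁱ++_)
import Data.List.Relation.Binary.Infix.Heterogeneous as Infix
import Data.List.Relation.Binary.Infix.Heterogeneous.Properties as Infix
open import Data.List.Relation.Binary.Prefix.Heterogeneous using (Prefix; []; _∷_; _++ᵖ_)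
import Data.List.Relation.Binary.Prefix.Heterogeneous.Properties as Prefix
open import Data.List.Relation.Binary.Pointwise using (≡⇒Pointwise-≡)
open import Data.List.Relation.Unary.All using (All)
import Data.List.Relation.Unary.All.Properties as All
open import Data.List.Relation.Unary.Unique.Propositional using (Unique)
import Data.List.Relation.Unary.Unique.Propositional.Properties as Unique
open import Data.Bool using (true; false)
open import Data.Maybe using (just)
open import Data.Product using (Σ; _,_)
open import Data.Sum using (_⊎_; inj₁; inj₂)
open import Function using (_∘_; id)
open import Relation.Nullary using (¬_; does; no; map′; contradiction)
open import Relation.Unary using (Decidable)
open import Relation.Binary.PropositionalEquality
  using (_≡_; refl; sym; trans; cong; subst; subst₂; module ≡-Reasoning)

module _ {A : Set} where

  prefix-++ˡ : ∀ {v : List A} xs {ys} → length v ≤ length xs →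
               Prefix _≡_ v (xs ++ ys) → Prefix _≡_ v xs
  prefix-++ˡ {[]}    xs       _         _        = []
  prefix-++ˡ {_ ∷ _} (x ∷ xs) (s≤s v≤xs) (p ∷ ps) = p ∷ prefix-++ˡ xs v≤xs ps

  length-∷ʳ : ∀ (u : List A) b → length (u ++ [ b ]) ≡ suc (length u)
  length-∷ʳ u b = trans (length-++ u) (+-comm (length u) 1)

  properInfix-split : ∀ {v : List A} a u b → Infix _≡_ v (a ∷ u ++ [ b ]) →
                      length v < length (a ∷ u ++ [ b ]) →
                      Infix _≡_ v (a ∷ u) ⊎ Infix _≡_ v (u ++ [ b ])
  properInfix-split a u b (here p) (s≤s v<) =
    inj₁ (here (prefix-++ˡ (a ∷ u) (subst (_ ≤_) (length-∷ʳ u b) v<) p))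
  properInfix-split a u b (there q) _ = inj₂ q

  replicate-++-infix : ∀ {m n} {a : A} xs ys → m ≤′ n →
                       Infix _≡_ (replicate m a ++ xs) (replicate n a ++ xs ++ ys)
  replicate-++-infix {m} {a = a} xs ys ≤′-refl =
    here (Prefix.++⁺ (≡⇒Pointwise-≡ {x = replicate m a} refl)
                      (Prefix.fromPointwise (≡⇒Pointwise-≡ {x = xs} refl) ++ᵖ ys))
  replicate-++-infix xs ys (≤′-step m≤n) = there (replicate-++-infix xs ys m≤n)

  module _ {P : A → Set} (P? : Decidable P) where

    length-filter-∷ : ∀ x xs → length (filter P? xs) ≤ length (filter P? (x ∷ xs))
    length-filter-∷ x xs with does (P? x)
    ... | true  = n≤1+n _
    ... | false = ≤-refl

    length-filter-infix : ∀ {xs ys} → Infix _≡_ xs ys →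
                          length (filter P? xs) ≤ length (filter P? ys)
    length-filter-infix (here p) =
      Prefix.length-mono (Prefix.filter⁺ P? P? (λ { refl → id }) (λ { refl → id }) p)
    length-filter-infix (there {y} {_} {ys} q) =
      ≤-trans (length-filter-infix q) (length-filter-∷ y ys)

infix⇒occurs : ∀ {w x} → Infix _≡_ w x → Occurs w x
infix⇒occurs w⊑x = there (Infix.map⁺ chr chr (Infix.map (cong chr) w⊑x) ⁱ++ [ $ ])

zeros : ℕ → Str
zeros n = replicate n 0

spike : ℕ → Str
spike k = zeros k ++ 1 ∷ zeros k

bridge : ℕ → Str
bridge n = 1 ∷ zeros n ++ [ 1 ]

isOne? : Decidable (_≡ chr 1)
isOne? $       = no λ ()
isOne? (chr n) = map′ (cong chr) (λ { refl → refl }) (n ≟ 1)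

ones : List Sym → ℕ
ones = length ∘ filter isOne?

ones-zeros-++ : ∀ k s → ones (map chr (zeros k) ++ s) ≡ ones s
ones-zeros-++ zero    s = refl
ones-zeros-++ (suc k) s = ones-zeros-++ k s

ones-bridge : ∀ n → ones (map chr (bridge n)) ≡ 2
ones-bridge n = cong suc (begin
  ones (map chr (zeros n ++ [ 1 ]))        ≡⟨ cong ones (map-++ chr (zeros n) [ 1 ]) ⟩
  ones (map chr (zeros n) ++ [ chr 1 ])    ≡⟨ ones-zeros-++ n [ chr 1 ] ⟩
  1                                         ∎)
  where open ≡-Reasoning

ones-spike : ∀ k → ones (text (spike k)) ≡ 1
ones-spike k = begin
  ones (map chr (zeros k ++ 1 ∷ zeros k) ++ [ $ ])
    ≡⟨ cong (ones ∘ (_++ [ $ ])) (map-++ chr (zeros k) (1 ∷ zeros k)) ⟩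
  ones ((map chr (zeros k) ++ map chr (1 ∷ zeros k)) ++ [ $ ])
    ≡⟨ cong ones (++-assoc (map chr (zeros k)) _ [ $ ]) ⟩
  ones (map chr (zeros k) ++ chr 1 ∷ map chr (zeros k) ++ [ $ ])
    ≡⟨ ones-zeros-++ k _ ⟩
  suc (ones (map chr (zeros k) ++ [ $ ]))
    ≡⟨ cong suc (ones-zeros-++ k [ $ ]) ⟩
  1 ∎
  where open ≡-Reasoning

bridge-absent : ∀ n k → ¬ Occurs (bridge n) (spike k)
bridge-absent n k occ = 1+n≰n (subst₂ _≤_ (ones-bridge n) (ones-spike k) (length-filter-infix isOne? occ))

zeros-one-infix : ∀ {n k} → n ≤ k → Infix _≡_ (zeros n ++ [ 1 ]) (spike k)
zeros-one-infix {n} n≤k = replicate-++-infix [ 1 ] (zeros _) (≤⇒≤′ n≤k)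

one-zeros-infix : ∀ {n k} → n ≤ k → Infix _≡_ (1 ∷ zeros n) (spike k)
one-zeros-infix {k = k} n≤k = zeros k ++ⁱ here (refl ∷ Prefix.replicate⁺ n≤k refl)

bridge-MAW : ∀ {n k} → n ≤ k → MAW (spike k) (bridge n)
bridge-MAW {n} {k} n≤k = bridge-absent n k , minimal
  where
  minimal : ∀ v → Infix _≡_ v (bridge n) → length v < length (bridge n) → Occurs v (spike k)
  minimal v v⊑ v< with properInfix-split 1 (zeros n) 1 v⊑ v<
  ... | inj₁ v⊑10ⁿ = infix⇒occurs (Infix.trans trans v⊑10ⁿ (one-zeros-infix n≤k))
  ... | inj₂ v⊑0ⁿ1 = infix⇒occurs (Infix.trans trans v⊑0ⁿ1 (zeros-one-infix n≤k))

runsFrom-zeros : ∀ n → runsFrom 0 (zeros n) ≡ 1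
runsFrom-zeros zero    = refl
runsFrom-zeros (suc n) = runsFrom-zeros n

runsFrom-zeros-++ : ∀ n xs → runsFrom 0 (zeros n ++ xs) ≡ runsFrom 0 xs
runsFrom-zeros-++ zero    xs = refl
runsFrom-zeros-++ (suc n) xs = runsFrom-zeros-++ n xs

runs-spike : ∀ k → runs (spike (suc k)) ≡ 3
runs-spike k = trans (runsFrom-zeros-++ k (1 ∷ zeros (suc k))) (cong (2 +_) (runsFrom-zeros k))

runs-bridge : ∀ n → runs (bridge (suc n)) ≡ 3
runs-bridge n = cong suc (runsFrom-zeros-++ n [ 1 ])

last-zeros : ∀ n → last (zeros (suc n)) ≡ just 0
last-zeros zero    = refl
last-zeros (suc n) = last-zeros n

bridge-M3 : ∀ {n k} → suc n ≤ k → M3 (spike k) (bridge (suc n))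
bridge-M3 {n} n<k =
  bridge-MAW n<k , 1 , zeros (suc n) , 1 , refl , runs-bridge n , (λ ()) ,
  λ eq → contradiction (trans eq (last-zeros n)) λ ()

length-bridge : ∀ n → length (bridge n) ≡ 2 + n
length-bridge n = cong suc (trans (length-∷ʳ (zeros n) 1) (cong suc (length-replicate n)))

bridge-injective : ∀ {m n} → bridge m ≡ bridge n → m ≡ n
bridge-injective {m} {n} eq =
  +-cancelˡ-≡ 2 m n (trans (sym (length-bridge m)) (trans (cong length eq) (length-bridge n)))

bridges : ℕ → List Str
bridges = applyUpTo (bridge ∘ suc)

bridges-unique : ∀ k → Unique (bridges k)
bridges-unique k = Unique.applyUpTo⁺₁ (bridge ∘ suc) k λ {i} {j} i<j _ eq →
  <-irrefl (suc-injective (bridge-injective {suc i} {suc j} eq)) i<j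

bridges-M3 : ∀ k → All (M3 (spike k)) (bridges k)
bridges-M3 k = All.applyUpTo⁺₁ (bridge ∘ suc) k bridge-M3

lemma3 : ¬ (Σ (ℕ → ℕ) (λ f → (x : Str) → 1 ≤ length x → AtMost (f (runs x)) (M3 x)))
lemma3 (f , bounded) = 1+n≰n (subst₂ _≤_ (length-applyUpTo (bridge ∘ suc) k) (cong f (runs-spike (f 3))) k≤f3)
  where
  k : ℕ
  k = suc (f 3)
  k≤f3 : length (bridges k) ≤ f (runs (spike k))
  k≤f3 = bounded (spike k) (s≤s z≤n) (bridges k) (bridges-unique k) (bridges-M3 k)
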